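{- Let $G$ be a complete graph on $2n$ nodes partitioned into $n$ pairs $\{p_i,q_i\}$, with edge weights in $\{1,2\}$. Let $G'$ be the graph obtained from $G$ by adding, for each $i$, a new dummy node $d_i$ and two weight-1 edges $\{p_i,d_i\},\{d_i,q_i\}$ (dummy nodes have no other edges). If $G'$ admits a $C_{6\times}$-cover using only weight-1 edges, then $G$ admits a feasible 2-matching, i.e., a coloring of the nodes of $G$ with, for each $i$, one of $p_i,q_i$ red and the other blue, together with a perfect matching of the red nodes and a perfect matching of the blue nodes, all of whose edges have weight $1$.
   Context: A $C_{6\times}$-cover of a graph is a collection of node-disjoint cycles covering all nodes, each of which has length in $\{6,12,18,\dots\}$ (a multiple of $6$). -}

module Defs where

open import Data.Nat using (ℕ; _*_; suc)
open import Data.Fin using (Fin)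
open import Data.Bool using (Bool; true; false; not)
open import Data.Product using (_×_; _,_; Σ; ∃)
open import Data.Sum using (_⊎_; inj₁; inj₂)
open import Data.Empty using (⊥)
open import Data.List using (List; []; _∷_; length; concat; concatMap)
open import Data.List.Relation.Unary.All using (All)
open import Data.List.Relation.Unary.Unique.Propositional using (Unique)
open import Data.List.Membership.Propositional using (_∈_)
open import Relation.Binary.PropositionalEquality using (_≡_; _≢_)
open import Function.Bundles using (_⇔_)

-- Nodes of G: the pair index i together with a side;
-- (i , true) is p_i and (i , false) is q_i.
Node : ℕ → Set
Node n = Fin n × Bool

-- Edge weights of the complete graph G on the 2n nodes:
-- w u v is the weight of edge {u,v} (only meaningful for u ≢ v).
Weight : ℕ → Set
Weight n = Node n → Node n → ℕ

ValidWeight : (n : ℕ) → Weight n → Set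
ValidWeight n w =
  (∀ u v → w u v ≡ w v u) × (∀ u v → u ≢ v → (w u v ≡ 1 ⊎ w u v ≡ 2))

-- Nodes of G': original nodes (inj₁) and dummy nodes d_i (inj₂ i).
Node' : ℕ → Set
Node' n = Node n ⊎ Fin n

Edge1' : (n : ℕ) → Weight n → Node' n → Node' n → Set
Edge1' n w (inj₁ u) (inj₁ v) = u ≢ v × w u v ≡ 1
Edge1' n w (inj₁ (i , b)) (inj₂ j) = i ≡ j
Edge1' n w (inj₂ j) (inj₁ (i , b)) = i ≡ j
Edge1' n w (inj₂ i) (inj₂ j) = ⊥

Path : {A : Set} → (A → A → Set) → A → List A → A → Set
Path E a [] b = E a b
Path E a (y ∷ ys) b = E a y × Path E y ys b

-- A list of vertices v0 … v(k-1) forms a closed walk using edges of E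
-- (consecutive vertices adjacent, and v(k-1) adjacent to v0).
ClosedWalk : {A : Set} → (A → A → Set) → List A → Set
ClosedWalk E [] = ⊥
ClosedWalk E (x ∷ xs) = Path E x xs x

Cycle6× : {A : Set} → (A → A → Set) → List A → Set
Cycle6× E c = ClosedWalk E c × Unique c × ∃ λ k → length c ≡ 6 * suc k

C6×Cover : {A : Set} → (A → A → Set) → List (List A) → Set
C6×Cover {A} E cs =
  All (Cycle6× E) cs × Unique (concat cs) × (∀ (v : A) → v ∈ concat cs)

-- Colouring: red i = true means p_i is red (and q_i blue); otherwise q_i red.
IsRed : {n : ℕ} → (Fin n → Bool) → Node n → Bool
IsRed red (i , true) = red i
IsRed red (i , false) = not (red i)

endpoints : {A : Set} → List (A × A) → List A
endpoints = concatMap (λ { (u , v) → u ∷ v ∷ [] })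

PerfectMatching1 : (n : ℕ) → Weight n → (Node n → Set) → List (Node n × Node n) → Set
PerfectMatching1 n w P M =
  All (λ { (u , v) → u ≢ v × w u v ≡ 1 }) M
  × Unique (endpoints M)
  × (∀ x → (x ∈ endpoints M) ⇔ P x)

Feasible2Matching : (n : ℕ) → Weight n → Set
Feasible2Matching n w =
  Σ (Fin n → Bool) λ red →
  Σ (List (Node n × Node n)) λ Mr →
  Σ (List (Node n × Node n)) λ Mb →
    PerfectMatching1 n w (λ x → IsRed red x ≡ true) Mr
    × PerfectMatching1 n w (λ x → IsRed red x ≡ false) Mb

-- Orient every cycle of the cover and label its arcs consecutively by
-- 0,1,2,… modulo 6; since every cycle length is a multiple of 6, the labels
-- wrap around consistently, so whenever an arc enters a node the arc leaving
-- it carries the next label.  Call an arc "inner" if both ends are nodes of G.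
-- Around a dummy node d_i the cover reads  u' → x → d_i → y → u  with
-- {x , y} = {p_i , q_i}: the two consecutive arcs at a node cannot go back and
-- forth (labels mod 6 would give l = l + 2), so d_i has two distinct
-- neighbours, which must be p_i and q_i.  Hence every node of G lies on exactly
-- one inner arc, and the inner arcs at x and y have labels l - 2 and l + 1,
-- i.e. opposite parities.  Colouring each node by the parity of its inner
-- arc gives a valid red/blue colouring, and the inner arcs of each parity form
-- a perfect weight-1 matching of the nodes of that colour.

module Submission where

open import Defs
open import Data.Nat using (ℕ; zero; suc; _*_)
open import Data.Nat.Properties using (*-suc)
open import Data.Fin using (Fin)
open import Data.Bool using (Bool; true; false; not; _xor_)
open import Data.Bool.Properties using (_≟_; not-involutive; not-¬; ¬-not)
open import Data.Product using (_×_; _,_; ∃; ∃₂; proj₁; proj₂; map₁; map₂)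
open import Data.Sum using (_⊎_; inj₁; inj₂)
open import Data.Empty using (⊥; ⊥-elim)
open import Data.List using (List; []; _∷_; length; concat; concatMap; map; _++_; _∷ʳ_)
open import Data.List.Properties using (map-++)
open import Data.List.Relation.Unary.All as All using (All; []; _∷_)
open import Data.List.Relation.Unary.All.Properties using (++⁺)
open import Data.List.Relation.Unary.Any using (here; there)
open import Data.List.Relation.Unary.AllPairs using ([]; _∷_)
open import Data.List.Relation.Unary.Unique.Propositional using (Unique)
open import Data.List.Membership.Propositional using (_∈_)
open import Data.List.Membership.Propositional.Properties
  using (∈-++⁺ˡ; ∈-++⁺ʳ; ∈-++⁻; ∈-map⁺; ∈-map⁻)
open import Data.List.Relation.Binary.Permutation.Propositional
  using (_↭_; ↭-sym; ↭-trans; ↭-reflexive; ↭⇒↭ₛ)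
open import Data.List.Relation.Binary.Permutation.Propositional.Properties
  using (∈-resp-↭; ∷↭∷ʳ)
  renaming (++⁺ to ↭-++⁺)
open import Data.List.Relation.Binary.Permutation.Setoid.Properties using (Unique-resp-↭)
open import Relation.Nullary using (yes; no)
open import Relation.Binary.PropositionalEquality
  using (_≡_; _≢_; refl; sym; trans; cong; cong₂; subst; setoid; module ≡-Reasoning)
open import Function.Bundles using (mk⇔)

-- Arc labels are the integers modulo 6.  Modulus 6 serves two purposes:
-- it is even, so parity is well defined, and it does not divide 2, so
-- l ≢ l + 2 (no arc is followed by its reverse).
data ℤ₆ : Set where
  z0 z1 z2 z3 z4 z5 : ℤ₆

succ₆ : ℤ₆ → ℤ₆
succ₆ z0 = z1
succ₆ z1 = z2
succ₆ z2 = z3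
succ₆ z3 = z4
succ₆ z4 = z5
succ₆ z5 = z0

_+₆_ : ℤ₆ → ℕ → ℤ₆
l +₆ zero = l
l +₆ suc m = succ₆ l +₆ m

parity : ℤ₆ → Bool
parity z0 = true
parity z1 = false
parity z2 = true
parity z3 = false
parity z4 = true
parity z5 = false

parity-succ₆ : ∀ l → parity (succ₆ l) ≡ not (parity l)
parity-succ₆ z0 = refl
parity-succ₆ z1 = refl
parity-succ₆ z2 = refl
parity-succ₆ z3 = refl
parity-succ₆ z4 = refl
parity-succ₆ z5 = refl

parity-succ₆² : ∀ l → parity (succ₆ (succ₆ l)) ≡ parity l
parity-succ₆² z0 = refl
parity-succ₆² z1 = refl
parity-succ₆² z2 = refl
parity-succ₆² z3 = refl
parity-succ₆² z4 = refl
parity-succ₆² z5 = refl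

parity-two-apart : ∀ {l k m} → k ≡ succ₆ l → m ≡ succ₆ k → parity l ≡ parity m
parity-two-apart {l} refl refl = sym (parity-succ₆² l)

succ₆²-≢ : ∀ l → l ≢ succ₆ (succ₆ l)
succ₆²-≢ z0 ()
succ₆²-≢ z1 ()
succ₆²-≢ z2 ()
succ₆²-≢ z3 ()
succ₆²-≢ z4 ()
succ₆²-≢ z5 ()

+₆-six : ∀ l → l +₆ 6 ≡ l
+₆-six z0 = refl
+₆-six z1 = refl
+₆-six z2 = refl
+₆-six z3 = refl
+₆-six z4 = refl
+₆-six z5 = refl

+₆-multiple : ∀ k l → l +₆ (6 * k) ≡ l
+₆-multiple zero l = refl
+₆-multiple (suc k) l = begin
  l +₆ (6 * suc k)       ≡⟨ cong (l +₆_) (*-suc 6 k) ⟩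
  (l +₆ 6) +₆ (6 * k)    ≡⟨ cong (_+₆ (6 * k)) (+₆-six l) ⟩
  l +₆ (6 * k)           ≡⟨ +₆-multiple k l ⟩
  l                      ∎
  where open ≡-Reasoning

unique-map⇒injective : {X Y : Set} {f : X → Y} {xs : List X} {x y : X} →
  Unique (map f xs) → x ∈ xs → y ∈ xs → f x ≡ f y → x ≡ y
unique-map⇒injective (_ ∷ _) (here refl) (here refl) _ = refl
unique-map⇒injective {f = f} (fresh ∷ _) (here refl) (there y∈) fx≡fy =
  ⊥-elim (All.lookup fresh (∈-map⁺ f y∈) fx≡fy)
unique-map⇒injective {f = f} (fresh ∷ _) (there x∈) (here refl) fx≡fy =
  ⊥-elim (All.lookup fresh (∈-map⁺ f x∈) (sym fx≡fy))
unique-map⇒injective (_ ∷ u) (there x∈) (there y∈) fx≡fy = unique-map⇒injective u x∈ y∈ fx≡fy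

module _ {X : Set} where

  ∈-endpoints⁻ : {M : List (X × X)} {z : X} →
    z ∈ endpoints M → ∃ λ w → (z , w) ∈ M ⊎ (w , z) ∈ M
  ∈-endpoints⁻ {(u , v) ∷ M} (here refl) = v , inj₁ (here refl)
  ∈-endpoints⁻ {(u , v) ∷ M} (there (here refl)) = u , inj₂ (here refl)
  ∈-endpoints⁻ {(u , v) ∷ M} (there (there z∈)) with ∈-endpoints⁻ z∈
  ... | w , inj₁ p = w , inj₁ (there p)
  ... | w , inj₂ p = w , inj₂ (there p)

  ∈-endpoints⁺ˡ : {M : List (X × X)} {z w : X} → (z , w) ∈ M → z ∈ endpoints M
  ∈-endpoints⁺ˡ (here refl) = here refl
  ∈-endpoints⁺ˡ {_ ∷ _} (there p) = there (there (∈-endpoints⁺ˡ p))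

  ∈-endpoints⁺ʳ : {M : List (X × X)} {z w : X} → (w , z) ∈ M → z ∈ endpoints M
  ∈-endpoints⁺ʳ (here refl) = there (here refl)
  ∈-endpoints⁺ʳ {_ ∷ _} (there p) = there (there (∈-endpoints⁺ʳ p))

  unique-endpoints : {M : List (X × X)} →
    Unique (map proj₁ M) → Unique (map proj₂ M) →
    (∀ {p q} → p ∈ M → q ∈ M → proj₁ p ≢ proj₂ q) →
    Unique (endpoints M)
  unique-endpoints {[]} [] [] _ = []
  unique-endpoints {(u , v) ∷ M} (fresh₁ ∷ u₁) (fresh₂ ∷ u₂) apart =
    (apart (here refl) (here refl) ∷ All.tabulate u-fresh)
    ∷ All.tabulate v-fresh
    ∷ unique-endpoints u₁ u₂ (λ p q → apart (there p) (there q))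
    where
    u-fresh : ∀ {z} → z ∈ endpoints M → u ≢ z
    u-fresh z∈ with ∈-endpoints⁻ z∈
    ... | _ , inj₁ p = All.lookup fresh₁ (∈-map⁺ proj₁ p)
    ... | _ , inj₂ p = apart (here refl) (there p)
    v-fresh : ∀ {z} → z ∈ endpoints M → v ≢ z
    v-fresh z∈ with ∈-endpoints⁻ z∈
    ... | _ , inj₁ p = λ v≡z → apart (there p) (here refl) (sym v≡z)
    ... | _ , inj₂ p = All.lookup fresh₂ (∈-map⁺ proj₂ p)

record Arc (A : Set) : Set where
  constructor arc
  field
    src tgt : A
    lab : ℤ₆

open Arc

module _ {A : Set} where

  Follows : Arc A → Arc A → Set
  Follows a a' = src a' ≡ tgt a × lab a' ≡ succ₆ (lab a)

  Successor : List (Arc A) → Arc A → Set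
  Successor as a = ∃ λ a' → a' ∈ as × Follows a a'

  successor-mono : {as bs : List (Arc A)} {a : Arc A} →
    (∀ {x} → x ∈ as → x ∈ bs) → Successor as a → Successor bs a
  successor-mono sub = map₂ (map₁ sub)

  walkArcs : ℤ₆ → A → List A → A → List (Arc A)
  walkArcs l a [] z = arc a z l ∷ []
  walkArcs l a (y ∷ ys) z = arc a y l ∷ walkArcs (succ₆ l) y ys z

  cycleArcs : List A → List (Arc A)
  cycleArcs [] = []
  cycleArcs (x ∷ xs) = walkArcs z0 x xs x

  coverArcs : List (List A) → List (Arc A)
  coverArcs = concatMap cycleArcs

  sources-walk : ∀ l a xs z → map src (walkArcs l a xs z) ≡ a ∷ xs
  sources-walk l a [] z = refl
  sources-walk l a (y ∷ ys) z = cong (a ∷_) (sources-walk (succ₆ l) y ys z)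

  targets-walk : ∀ l a xs z → map tgt (walkArcs l a xs z) ≡ xs ∷ʳ z
  targets-walk l a [] z = refl
  targets-walk l a (y ∷ ys) z = cong (y ∷_) (targets-walk (succ₆ l) y ys z)

  sources-cover : ∀ cs → map src (coverArcs cs) ≡ concat cs
  sources-cover [] = refl
  sources-cover ([] ∷ cs) = sources-cover cs
  sources-cover ((x ∷ xs) ∷ cs) = begin
    map src (walkArcs z0 x xs x ++ coverArcs cs)
      ≡⟨ map-++ src (walkArcs z0 x xs x) (coverArcs cs) ⟩
    map src (walkArcs z0 x xs x) ++ map src (coverArcs cs)
      ≡⟨ cong₂ _++_ (sources-walk z0 x xs x) (sources-cover cs) ⟩
    (x ∷ xs) ++ concat cs ∎
    where open ≡-Reasoning

  targets-cover : ∀ cs → map tgt (coverArcs cs) ↭ concat cs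
  targets-cover [] = ↭-reflexive refl
  targets-cover ([] ∷ cs) = targets-cover cs
  targets-cover ((x ∷ xs) ∷ cs) =
    ↭-trans
      (↭-reflexive (trans (map-++ tgt (walkArcs z0 x xs x) (coverArcs cs))
                          (cong (_++ map tgt (coverArcs cs)) (targets-walk z0 x xs x))))
      (↭-++⁺ (↭-sym (∷↭∷ʳ x xs)) (targets-cover cs))

  module _ {R : A → A → Set} where

    walk-edges : ∀ l a xs z → Path R a xs z → All (λ e → R (src e) (tgt e)) (walkArcs l a xs z)
    walk-edges l a [] z r = r ∷ []
    walk-edges l a (y ∷ ys) z (r , rs) = r ∷ walk-edges (succ₆ l) y ys z rs

    cover-edges : ∀ cs → All (Cycle6× R) cs → All (λ e → R (src e) (tgt e)) (coverArcs cs)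
    cover-edges [] [] = []
    cover-edges ([] ∷ cs) ((() , _) ∷ _)
    cover-edges ((x ∷ xs) ∷ cs) ((walk , _) ∷ cycles) =
      ++⁺ (walk-edges z0 x xs x walk) (cover-edges cs cycles)

  walk-first : ∀ l a xs z → ∃ λ y → arc a y l ∈ walkArcs l a xs z
  walk-first l a [] z = z , here refl
  walk-first l a (y ∷ ys) z = y , here refl

  walk-successor : ∀ l a xs z {e} → e ∈ walkArcs l a xs z →
    Successor (walkArcs l a xs z) e ⊎ (tgt e ≡ z × succ₆ (lab e) ≡ l +₆ suc (length xs))
  walk-successor l a [] z (here refl) = inj₂ (refl , refl)
  walk-successor l a (y ∷ ys) z (here refl) =
    let (t , first) = walk-first (succ₆ l) y ys z in inj₁ (arc y t (succ₆ l) , there first , refl , refl)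
  walk-successor l a (y ∷ ys) z {e} (there e∈) with walk-successor (succ₆ l) y ys z e∈
  ... | inj₁ s = inj₁ (successor-mono {a = e} there s)
  ... | inj₂ last = inj₂ last

  -- In a cycle of length 6k every arc has a successor: the last arc is
  -- followed by the first one, whose label 0 is the wrapped-around label.
  cycle-successor : {R : A → A → Set} → ∀ c → Cycle6× R c → ∀ {e} → e ∈ cycleArcs c →
    Successor (cycleArcs c) e
  cycle-successor [] (() , _)
  cycle-successor (x ∷ xs) (_ , _ , k , len) {e} e∈ with walk-successor z0 x xs x e∈
  ... | inj₁ s = s
  ... | inj₂ (enters-x , label) =
    let (y , first) = walk-first z0 x xs x in arc x y z0 , first , sym enters-x , wraps
    where
    wraps : z0 ≡ succ₆ (lab e)
    wraps = begin
      z0                        ≡⟨ sym (+₆-multiple (suc k) z0) ⟩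
      z0 +₆ (6 * suc k)         ≡⟨ cong (z0 +₆_) (sym len) ⟩
      z0 +₆ suc (length xs)     ≡⟨ sym label ⟩
      succ₆ (lab e)             ∎
      where open ≡-Reasoning

  cover-successor : {R : A → A → Set} → ∀ cs → All (Cycle6× R) cs → ∀ {e} → e ∈ coverArcs cs →
    Successor (coverArcs cs) e
  cover-successor (c ∷ cs) (cycle ∷ cycles) {e} e∈ with ∈-++⁻ (cycleArcs c) e∈
  ... | inj₁ e∈c = successor-mono {a = e} ∈-++⁺ˡ (cycle-successor c cycle e∈c)
  ... | inj₂ e∈cs = successor-mono {a = e} (∈-++⁺ʳ (cycleArcs c)) (cover-successor cs cycles e∈cs)

module Consecutive {A : Set} (arcs : List (Arc A))
  (uniqueSources : Unique (map src arcs))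
  (successor : ∀ {e} → e ∈ arcs → Successor arcs e) where

  same-source : ∀ {e e'} → e ∈ arcs → e' ∈ arcs → src e ≡ src e' → e ≡ e'
  same-source = unique-map⇒injective uniqueSources

  next-label : ∀ {e e'} → e ∈ arcs → e' ∈ arcs → src e' ≡ tgt e → lab e' ≡ succ₆ (lab e)
  next-label e∈ e'∈ e'-after-e with successor e∈
  ... | e'' , e''∈ , src-e'' , lab-e'' =
    trans (cong lab (same-source e'∈ e''∈ (trans e'-after-e (sym src-e'')))) lab-e''

  no-back-arc : ∀ {e e'} → e ∈ arcs → e' ∈ arcs → src e' ≡ tgt e → tgt e' ≡ src e → ⊥
  no-back-arc {e} e∈ e'∈ forth back =
    succ₆²-≢ (lab e) (trans (next-label e'∈ e∈ (sym back)) (cong succ₆ (next-label e∈ e'∈ forth)))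

module Matching {X Y : Set} where

  matching : Bool → List (Arc (X ⊎ Y)) → List (X × X)
  matching b [] = []
  matching b (arc (inj₁ x) (inj₁ y) k ∷ as) with parity k ≟ b
  ... | yes _ = (x , y) ∷ matching b as
  ... | no _ = matching b as
  matching b (arc (inj₁ x) (inj₂ _) _ ∷ as) = matching b as
  matching b (arc (inj₂ _) _ _ ∷ as) = matching b as

  ∈-matching⁻ : ∀ {b as x y} → (x , y) ∈ matching b as →
    ∃ λ k → parity k ≡ b × arc (inj₁ x) (inj₁ y) k ∈ as
  ∈-matching⁻ {b} {arc (inj₁ _) (inj₁ _) k ∷ as} p∈ with parity k ≟ b
  ∈-matching⁻ {b} {arc (inj₁ _) (inj₁ _) k ∷ as} (here refl) | yes par = k , par , here refl
  ∈-matching⁻ {b} {arc (inj₁ _) (inj₁ _) k ∷ as} (there p∈) | yes _ = map₂ (map₂ there) (∈-matching⁻ p∈)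
  ∈-matching⁻ {b} {arc (inj₁ _) (inj₁ _) k ∷ as} p∈ | no _ = map₂ (map₂ there) (∈-matching⁻ p∈)
  ∈-matching⁻ {b} {arc (inj₁ _) (inj₂ _) _ ∷ as} p∈ = map₂ (map₂ there) (∈-matching⁻ p∈)
  ∈-matching⁻ {b} {arc (inj₂ _) _ _ ∷ as} p∈ = map₂ (map₂ there) (∈-matching⁻ p∈)

  matching-∷ : ∀ {b as p} e → p ∈ matching b as → p ∈ matching b (e ∷ as)
  matching-∷ {b} (arc (inj₁ _) (inj₁ _) k) p∈ with parity k ≟ b
  ... | yes _ = there p∈
  ... | no _ = p∈
  matching-∷ (arc (inj₁ _) (inj₂ _) _) p∈ = p∈
  matching-∷ (arc (inj₂ _) _ _) p∈ = p∈

  ∈-matching⁺ : ∀ {b as x y k} → parity k ≡ b → arc (inj₁ x) (inj₁ y) k ∈ as → (x , y) ∈ matching b as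
  ∈-matching⁺ {b} {k = k} par (here refl) with parity k ≟ b
  ... | yes _ = here refl
  ... | no wrong = ⊥-elim (wrong par)
  ∈-matching⁺ {as = e ∷ as} par (there e∈) = matching-∷ {as = as} e (∈-matching⁺ par e∈)

  matching-unique : ∀ b (f : Arc (X ⊎ Y) → X ⊎ Y) (g : X × X → X) →
    (∀ {x y k} → f (arc (inj₁ x) (inj₁ y) k) ≡ inj₁ (g (x , y))) →
    ∀ as → Unique (map f as) → Unique (map g (matching b as))
  matching-unique b f g f≡g [] [] = []
  matching-unique b f g f≡g (arc (inj₁ x) (inj₁ y) k ∷ as) (fresh ∷ u) with parity k ≟ b
  ... | yes _ = All.tabulate g-fresh ∷ matching-unique b f g f≡g as u
    where
    g-fresh : ∀ {z} → z ∈ map g (matching b as) → g (x , y) ≢ z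
    g-fresh z∈ gxy≡z with ∈-map⁻ g z∈
    ... | p , p∈ , refl =
      All.lookup fresh (∈-map⁺ f (proj₂ (proj₂ (∈-matching⁻ p∈))))
        (trans f≡g (trans (cong inj₁ gxy≡z) (sym f≡g)))
  ... | no _ = matching-unique b f g f≡g as u
  matching-unique b f g f≡g (arc (inj₁ _) (inj₂ _) _ ∷ as) (_ ∷ u) = matching-unique b f g f≡g as u
  matching-unique b f g f≡g (arc (inj₂ _) _ _ ∷ as) (_ ∷ u) = matching-unique b f g f≡g as u

IsRed-xor : ∀ {n} (red : Fin n → Bool) i s p → red i ≡ s xor p →
  IsRed red (i , s) ≡ not p × IsRed red (i , not s) ≡ p
IsRed-xor red i true p red≡ = red≡ , trans (cong not red≡) (not-involutive p)
IsRed-xor red i false p red≡ = cong not red≡ , red≡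

module CoverToMatching (n : ℕ) (w : Weight n) (cs : List (List (Node' n)))
  (cover : C6×Cover (Edge1' n w) cs) where

  open Matching {Node n} {Fin n}

  arcs : List (Arc (Node' n))
  arcs = coverArcs cs

  cycles : All (Cycle6× (Edge1' n w)) cs
  cycles = proj₁ cover

  uniqueSources : Unique (map src arcs)
  uniqueSources = subst Unique (sym (sources-cover cs)) (proj₁ (proj₂ cover))

  uniqueTargets : Unique (map tgt arcs)
  uniqueTargets = Unique-resp-↭ (setoid _) (↭⇒↭ₛ (↭-sym (targets-cover cs))) (proj₁ (proj₂ cover))

  leaving : ∀ v → ∃ λ e → e ∈ arcs × v ≡ src e
  leaving v = ∈-map⁻ src (subst (v ∈_) (sym (sources-cover cs)) (proj₂ (proj₂ cover) v))

  entering : ∀ v → ∃ λ e → e ∈ arcs × v ≡ tgt e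
  entering v = ∈-map⁻ tgt (∈-resp-↭ (↭-sym (targets-cover cs)) (proj₂ (proj₂ cover) v))

  isEdge : ∀ {e} → e ∈ arcs → Edge1' n w (src e) (tgt e)
  isEdge = All.lookup (cover-edges cs cycles)

  same-target : ∀ {e e'} → e ∈ arcs → e' ∈ arcs → tgt e ≡ tgt e' → e ≡ e'
  same-target = unique-map⇒injective uniqueTargets

  open Consecutive arcs uniqueSources (cover-successor cs cycles)

  dummy-successor : ∀ i → ∃₂ λ s l → arc (inj₂ i) (inj₁ (i , s)) l ∈ arcs
  dummy-successor i with leaving (inj₂ i)
  ... | arc _ (inj₂ _) _ , e∈ , refl = ⊥-elim (isEdge e∈)
  ... | arc _ (inj₁ (j , s)) l , e∈ , refl with isEdge e∈
  ...   | refl = s , l , e∈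

  dummy-predecessor : ∀ i → ∃₂ λ s k → arc (inj₁ (i , s)) (inj₂ i) k ∈ arcs
  dummy-predecessor i with entering (inj₂ i)
  ... | arc (inj₂ _) _ _ , e∈ , refl = ⊥-elim (isEdge e∈)
  ... | arc (inj₁ (j , s)) _ k , e∈ , refl with isEdge e∈
  ...   | refl = s , k , e∈

  -- After d_i → y the cycle continues along an inner arc, since it cannot
  -- return to d_i.
  after-dummy : ∀ {i s l} → arc (inj₂ i) (inj₁ (i , s)) l ∈ arcs →
    ∃ λ u → arc (inj₁ (i , s)) (inj₁ u) (succ₆ l) ∈ arcs
  after-dummy {i} {s} e∈ with leaving (inj₁ (i , s))
  ... | arc _ (inj₁ u) _ , e'∈ , refl =
    u , subst (λ k → arc (inj₁ (i , s)) (inj₁ u) k ∈ arcs) (next-label e∈ e'∈ refl) e'∈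
  ... | arc _ (inj₂ _) _ , e'∈ , refl with isEdge e'∈
  ...   | refl = ⊥-elim (no-back-arc e∈ e'∈ refl refl)

  before-dummy : ∀ {i s k} → arc (inj₁ (i , s)) (inj₂ i) k ∈ arcs →
    ∃₂ λ u l → arc (inj₁ u) (inj₁ (i , s)) l ∈ arcs × k ≡ succ₆ l
  before-dummy {i} {s} e∈ with entering (inj₁ (i , s))
  ... | arc (inj₁ u) _ l , e'∈ , refl = u , l , e'∈ , next-label e'∈ e∈ refl
  ... | arc (inj₂ _) _ _ , e'∈ , refl with isEdge e'∈
  ...   | refl = ⊥-elim (no-back-arc e'∈ e∈ refl refl)

  -- The part  u' → x → d_i → y → u  of the cover around the dummy d_i,
  -- where y = (i , side) and x = (i , not side).
  record Gadget (i : Fin n) : Set where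
    field
      side : Bool
      label : ℤ₆
      leave : arc (inj₂ i) (inj₁ (i , side)) label ∈ arcs
      enterLabel : ℤ₆
      enter : arc (inj₁ (i , not side)) (inj₂ i) enterLabel ∈ arcs
      outNode : Node n
      outArc : arc (inj₁ (i , side)) (inj₁ outNode) (succ₆ label) ∈ arcs
      inNode : Node n
      inLabel : ℤ₆
      inArc : arc (inj₁ inNode) (inj₁ (i , not side)) inLabel ∈ arcs
      inParity : parity inLabel ≡ parity label

  gadget : ∀ i → Gadget i
  gadget i with dummy-successor i | dummy-predecessor i
  ... | s , l , leave | s' , k , enter' = record
    { side = s ; label = l ; leave = leave ; enterLabel = k ; enter = enter
    ; outNode = proj₁ (after-dummy leave) ; outArc = proj₂ (after-dummy leave)
    ; inNode = proj₁ previous ; inLabel = proj₁ (proj₂ previous)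
    ; inArc = proj₁ (proj₂ (proj₂ previous))
    ; inParity = parity-two-apart (proj₂ (proj₂ (proj₂ previous))) (next-label enter leave refl) }
    where
    -- d_i has two distinct neighbours, so x and y are the two nodes of pair i.
    enter : arc (inj₁ (i , not s)) (inj₂ i) k ∈ arcs
    enter = subst (λ t → arc (inj₁ (i , t)) (inj₂ i) k ∈ arcs)
              (¬-not (λ s'≡s → no-back-arc leave enter' (cong (λ t → inj₁ (i , t)) s'≡s) refl)) enter'
    previous : ∃₂ λ u l' → arc (inj₁ u) (inj₁ (i , not s)) l' ∈ arcs × k ≡ succ₆ l'
    previous = before-dummy enter

  module At (i : Fin n) = Gadget (gadget i)

  inner-out : ∀ {i s y k} → arc (inj₁ (i , s)) (inj₁ y) k ∈ arcs →
    s ≡ At.side i × k ≡ succ₆ (At.label i)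
  inner-out {i} {s} e∈ with s ≟ At.side i
  ... | yes refl = refl , cong lab (same-source e∈ (At.outArc i) refl)
  ... | no s≢side with cong tgt (same-source e∈ (At.enter i) (cong (λ t → inj₁ (i , t)) (¬-not s≢side)))
  ...   | ()

  inner-in : ∀ {i s y k} → arc (inj₁ y) (inj₁ (i , s)) k ∈ arcs →
    s ≡ not (At.side i) × k ≡ At.inLabel i
  inner-in {i} {s} e∈ with s ≟ At.side i
  ... | no s≢side with ¬-not s≢side
  ...   | refl = refl , cong lab (same-target e∈ (At.inArc i) refl)
  inner-in {i} {s} e∈ | yes refl with cong src (same-target e∈ (At.leave i) refl)
  ...   | ()

  -- Each node is coloured by the parity of its inner arc.
  red : Fin n → Bool
  red i = At.side i xor parity (At.label i)

  colour-side : ∀ i → IsRed red (i , At.side i) ≡ parity (succ₆ (At.label i))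
  colour-side i = trans (proj₁ (IsRed-xor red i (At.side i) (parity (At.label i)) refl))
                        (sym (parity-succ₆ (At.label i)))

  colour-other : ∀ i → IsRed red (i , not (At.side i)) ≡ parity (At.inLabel i)
  colour-other i = trans (proj₂ (IsRed-xor red i (At.side i) (parity (At.label i)) refl))
                         (sym (At.inParity i))

  endpoint⇒colour : ∀ {b x} → x ∈ endpoints (matching b arcs) → IsRed red x ≡ b
  endpoint⇒colour {b} {i , s} x∈ with ∈-endpoints⁻ x∈
  ... | _ , inj₁ p∈ with ∈-matching⁻ p∈
  ...   | _ , par , e∈ with inner-out e∈
  ...     | refl , refl = trans (colour-side i) par
  endpoint⇒colour {b} {i , s} x∈ | _ , inj₂ p∈ with ∈-matching⁻ p∈
  ...   | _ , par , e∈ with inner-in e∈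
  ...     | refl , refl = trans (colour-other i) par

  colour⇒endpoint : ∀ {b x} → IsRed red x ≡ b → x ∈ endpoints (matching b arcs)
  colour⇒endpoint {b} {i , s} colour with s ≟ At.side i
  ... | yes refl = ∈-endpoints⁺ˡ (∈-matching⁺ (trans (sym (colour-side i)) colour) (At.outArc i))
  ... | no s≢side with ¬-not s≢side
  ...   | refl = ∈-endpoints⁺ʳ (∈-matching⁺ (trans (sym (colour-other i)) colour) (At.inArc i))

  source≢target : ∀ {b p q} → p ∈ matching b arcs → q ∈ matching b arcs → proj₁ p ≢ proj₂ q
  source≢target p∈ q∈ refl =
    not-¬ (proj₁ (inner-out (proj₂ (proj₂ (∈-matching⁻ p∈)))))
          (proj₁ (inner-in (proj₂ (proj₂ (∈-matching⁻ q∈)))))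

  perfect : ∀ b → PerfectMatching1 n w (λ x → IsRed red x ≡ b) (matching b arcs)
  perfect b =
    All.tabulate (λ { {x , y} p∈ → isEdge (proj₂ (proj₂ (∈-matching⁻ p∈))) })
    , unique-endpoints (matching-unique b src proj₁ refl arcs uniqueSources)
                       (matching-unique b tgt proj₂ refl arcs uniqueTargets)
                       source≢target
    , λ x → mk⇔ endpoint⇒colour colour⇒endpoint

  feasible : Feasible2Matching n w
  feasible = red , matching true arcs , matching false arcs , perfect true , perfect false

lemma4 : (n : ℕ) (w : Weight n) → ValidWeight n w →
    (cs : List (List (Node' n))) → C6×Cover (Edge1' n w) cs →
    Feasible2Matching n w
lemma4 n w _ cs cover = CoverToMatching.feasible n w cs cover
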